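{- For integers $i\ge0$, $j\ge0$, $j_1\ge0$, $j_2\ge0$ and real $k,k_1,k_2$: (a) $b_{i,j_1+j_2,0}=\sum_{r=0}^{i}\binom{i}{r}b_{r,j_1,k}\,b_{i-r,j_2,-k}$; (b) $b_{i,j,0}=\sum_{r=0}^{i}\binom{i}{r}k^r\,b_{i-r,j,-k}$; (c) $b_{i,j,k}=\sum_{r=0}^{i}\binom{i}{r}k^{i-r}\,b_{r,j,0}$; (d) $b_{i,j,k_1+k_2}=\sum_{r=0}^{i}\binom{i}{r}k_1^{i-r}\,b_{r,j,k_2}$; (e) if $j\ge1$, then $j\,b_{i,j-1,k+1}=\sum_{r=0}^{i}\binom{i}{r}k^{i-r}\,b_{r+1,j,0}$.
   Context: For integers $i\ge0$, $j\ge0$ and real $k$, $b_{i,j,k}=\sum_{r=0}^{j}\binom{j}{r}(-1)^{j-r}(r+k)^i$, with the convention $0^0=1$. -}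

module Defs where

open import Level using (Level)
open import Data.Nat.Base using (ℕ; zero; suc; _∸_)
open import Data.Nat.Combinatorics using (_C_)
open import Algebra.Bundles using (CommutativeRing; Semiring)
import Algebra.Definitions.RawSemiring as RS

module Ops {c ℓ : Level} (R : CommutativeRing c ℓ) where
  open CommutativeRing R hiding (zero)
  open RS (Semiring.rawSemiring semiring) public using (_×_; _^_)

  ⟦_⟧ : ℕ → Carrier
  ⟦ n ⟧ = n × 1#

  Σ[0≤r≤_] : ℕ → (ℕ → Carrier) → Carrier
  Σ[0≤r≤ zero ] f = f zero
  Σ[0≤r≤ suc n ] f = Σ[0≤r≤ n ] f + f (suc n)

  -- b_{i,j,k} = Σ_{r=0}^{j} C(j,r) (-1)^{j-r} (r+k)^i   (with x^0 = 1, so 0^0 = 1)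
  b : ℕ → ℕ → Carrier → Carrier
  b i j k = Σ[0≤r≤ j ] (λ r → (j C r) × ((- 1#) ^ (j ∸ r) * (⟦ r ⟧ + k) ^ i))

-- b i j k is the j-th forward difference Δʲ of m ↦ (m + k)ⁱ at m = 0, where
-- Δʲ f n = Σ_r C(j,r) (-1)^(j-r) f (n + r).  Pascal's rule gives
-- Δʲ⁺¹ f n = Δʲ f (n + 1) − Δʲ f n, hence Δ^(j₁+j₂) = Δ^j₁ ∘ Δ^j₂, and Δʲ is linear.
-- Parts (b)–(d) expand the power by the binomial theorem and apply Δʲ termwise.
-- For (a), write r₁ + r₂ = (r₁ + k) + (r₂ − k), expand, and factor the double
-- difference of a product of a function of r₁ and a function of r₂.
-- For (e), the absorption identity (r+1) C(j+1,r+1) = (j+1) C(j,r) turns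
-- Δʲ⁺¹ (m ↦ m g m) 0 into (j+1) Δʲ (m ↦ g (m+1)) 0, and m (m + k)ⁱ is expanded binomially.
module Submission where

open import Defs
open import Level using (Level)
open import Data.Nat.Base using (ℕ; suc; _∸_)
import Data.Nat.Base as N
open import Data.Nat.Combinatorics using (_C_)
open import Data.Product using () renaming (_×_ to _∧_)
open import Algebra.Bundles using (CommutativeRing)

open import Data.Product using (_,_)
open import Data.Nat.Base using (zero; z≤n; s≤s)
open import Data.Fin.Base using (toℕ)
import Data.Nat.Properties as NP
open import Data.Nat.Combinatorics
  using (nCk+nC[k+1]≡[n+1]C[k+1]; nCn≡1; nC1≡n; nCk≡nC[n∸k])
open import Data.Nat.Combinatorics.Specification using (k>n⇒nCk≡0)
import Relation.Binary.PropositionalEquality as P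
import Algebra.Properties.CommutativeSemigroup as CommSemigroupProperties
import Algebra.Properties.CommutativeMonoid.Mult as CommMonoidMult
import Algebra.Properties.Semiring.Mult as SemiringMult
import Algebra.Properties.Semiring.Exp as SemiringExp
import Algebra.Properties.Semiring.Sum as SemiringSum
import Algebra.Properties.CommutativeSemiring.Binomial as Binomial
import Algebra.Properties.Ring as RingProperties
import Relation.Binary.Reasoning.Setoid as SetoidReasoning

nC0≡1 : ∀ n → n C 0 P.≡ 1
nC0≡1 n = P.trans (nCk≡nC[n∸k] {0} {n} z≤n) (nCn≡1 n)

[1+k]*[1+n]C[1+k]≡[1+n]*nCk : ∀ n k → suc k N.* (suc n C suc k) P.≡ suc n N.* (n C k)
[1+k]*[1+n]C[1+k]≡[1+n]*nCk n zero =
  P.trans (NP.*-identityˡ (suc n C 1))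
    (P.trans (nC1≡n (suc n)) (P.sym (P.trans (P.cong (suc n N.*_) (nC0≡1 n)) (NP.*-identityʳ (suc n)))))
[1+k]*[1+n]C[1+k]≡[1+n]*nCk zero (suc k) =
  P.trans (P.cong (suc (suc k) N.*_) (k>n⇒nCk≡0 (s≤s (s≤s (z≤n {k})))))
    (P.trans (NP.*-zeroʳ (suc (suc k))) (P.sym (P.cong (1 N.*_) (k>n⇒nCk≡0 (s≤s (z≤n {k}))))))
[1+k]*[1+n]C[1+k]≡[1+n]*nCk (suc n) (suc k) = begin
  suc (suc k) N.* (suc (suc n) C suc (suc k))
    ≡⟨ P.cong (suc (suc k) N.*_) (P.sym (nCk+nC[k+1]≡[n+1]C[k+1] (suc n) (suc k))) ⟩
  suc (suc k) N.* (A N.+ B)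
    ≡⟨ NP.*-distribˡ-+ (suc (suc k)) A B ⟩
  (A N.+ suc k N.* A) N.+ suc (suc k) N.* B
    ≡⟨ P.cong₂ N._+_ (P.cong (A N.+_) ([1+k]*[1+n]C[1+k]≡[1+n]*nCk n k))
                     ([1+k]*[1+n]C[1+k]≡[1+n]*nCk n (suc k)) ⟩
  (A N.+ suc n N.* (n C k)) N.+ suc n N.* (n C suc k)
    ≡⟨ NP.+-assoc A _ _ ⟩
  A N.+ (suc n N.* (n C k) N.+ suc n N.* (n C suc k))
    ≡⟨ P.cong (A N.+_) (P.sym (NP.*-distribˡ-+ (suc n) (n C k) (n C suc k))) ⟩
  A N.+ suc n N.* (n C k N.+ n C suc k)
    ≡⟨ P.cong (λ z → A N.+ suc n N.* z) (nCk+nC[k+1]≡[n+1]C[k+1] n k) ⟩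
  suc (suc n) N.* A ∎
  where
  open P.≡-Reasoning
  A = suc n C suc k
  B = suc n C suc (suc k)

module _ {c ℓ : Level} (R : CommutativeRing c ℓ) where
  open CommutativeRing R
  open Ops R
  open SemiringMult semiring using (×-comm-*; ×-assoc-*; ×-homo-+; ×-congʳ; ×-congˡ; ×-assocˡ)
  open CommMonoidMult +-commutativeMonoid using (×-distrib-+)
  open SemiringExp semiring using (^-congˡ; ^-congʳ)
  open SemiringSum semiring using (sum; sum-replicate; sum-replicate-zero)
  open RingProperties ring using (-1*x≈-x; -‿+-comm; -‿distribˡ-*)
  module +-Properties = CommSemigroupProperties +-commutativeSemigroup
  module *-Properties = CommSemigroupProperties *-commutativeSemigroup
  open SetoidReasoning setoid

  ×-zeroʳ : ∀ n → n × 0# ≈ 0#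
  ×-zeroʳ n = trans (sym (sum-replicate n)) (sum-replicate-zero n)

  ×-neg : ∀ n x → n × (- x) ≈ - (n × x)
  ×-neg n x = trans (×-congʳ n (sym (-1*x≈-x x))) (trans (sym (×-comm-* n (- 1#) x)) (-1*x≈-x _))

  ×-swap : ∀ m n x → m × (n × x) ≈ n × (m × x)
  ×-swap m n x = trans (×-assocˡ x m n) (trans (×-congˡ (NP.*-comm m n)) (sym (×-assocˡ x n m)))

  Σ-cong≤ : ∀ n {f g : ℕ → Carrier} → (∀ r → r N.≤ n → f r ≈ g r) → Σ[0≤r≤ n ] f ≈ Σ[0≤r≤ n ] g
  Σ-cong≤ zero f≈g = f≈g 0 z≤n
  Σ-cong≤ (suc n) f≈g = +-cong (Σ-cong≤ n (λ r r≤n → f≈g r (NP.m≤n⇒m≤1+n r≤n))) (f≈g (suc n) NP.≤-refl)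

  Σ-cong : ∀ n {f g : ℕ → Carrier} → (∀ r → f r ≈ g r) → Σ[0≤r≤ n ] f ≈ Σ[0≤r≤ n ] g
  Σ-cong n f≈g = Σ-cong≤ n (λ r _ → f≈g r)

  Σ-unfoldˡ : ∀ n (f : ℕ → Carrier) → Σ[0≤r≤ suc n ] f ≈ f 0 + Σ[0≤r≤ n ] (λ r → f (suc r))
  Σ-unfoldˡ zero f = refl
  Σ-unfoldˡ (suc n) f = trans (+-congʳ (Σ-unfoldˡ n f)) (+-assoc _ _ _)

  Σ-distrib-+ : ∀ n (f g : ℕ → Carrier) → Σ[0≤r≤ n ] (λ r → f r + g r) ≈ Σ[0≤r≤ n ] f + Σ[0≤r≤ n ] g
  Σ-distrib-+ zero f g = refl
  Σ-distrib-+ (suc n) f g = trans (+-congʳ (Σ-distrib-+ n f g)) (+-Properties.interchange _ _ _ _)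

  -‿distrib-Σ : ∀ n (f : ℕ → Carrier) → - Σ[0≤r≤ n ] f ≈ Σ[0≤r≤ n ] (λ r → - f r)
  -‿distrib-Σ zero f = refl
  -‿distrib-Σ (suc n) f = trans (sym (-‿+-comm _ _)) (+-congʳ (-‿distrib-Σ n f))

  *-distribˡ-Σ : ∀ n x (f : ℕ → Carrier) → x * Σ[0≤r≤ n ] f ≈ Σ[0≤r≤ n ] (λ r → x * f r)
  *-distribˡ-Σ zero x f = refl
  *-distribˡ-Σ (suc n) x f = trans (distribˡ x _ _) (+-congʳ (*-distribˡ-Σ n x f))

  ×-distrib-Σ : ∀ n m (f : ℕ → Carrier) → m × Σ[0≤r≤ n ] f ≈ Σ[0≤r≤ n ] (λ r → m × f r)
  ×-distrib-Σ zero m f = refl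
  ×-distrib-Σ (suc n) m f = trans (×-distrib-+ _ _ m) (+-congʳ (×-distrib-Σ n m f))

  Σ-comm : ∀ n m (g : ℕ → ℕ → Carrier) →
    Σ[0≤r≤ n ] (λ r → Σ[0≤r≤ m ] (g r)) ≈ Σ[0≤r≤ m ] (λ s → Σ[0≤r≤ n ] (λ r → g r s))
  Σ-comm zero m g = refl
  Σ-comm (suc n) m g = trans (+-congʳ (Σ-comm n m g)) (sym (Σ-distrib-+ m _ _))

  Σ≈sum : ∀ n (f : ℕ → Carrier) → Σ[0≤r≤ n ] f ≈ sum {suc n} (λ r → f (toℕ r))
  Σ≈sum zero f = sym (+-identityʳ _)
  Σ≈sum (suc n) f = trans (Σ-unfoldˡ n f) (+-congˡ (Σ≈sum n (λ r → f (suc r))))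

  binomial : ∀ n x y → (x + y) ^ n ≈ Σ[0≤r≤ n ] (λ r → (n C r) × (x ^ r * y ^ (n ∸ r)))
  binomial n x y = trans (Binomial.theorem commutativeSemiring n x y) (sym (Σ≈sum n _))

  Σ-pascal : ∀ n (T : ℕ → Carrier) →
    Σ[0≤r≤ suc n ] (λ r → (suc n C r) × T r) ≈
    Σ[0≤r≤ n ] (λ r → (n C r) × T r) + Σ[0≤r≤ n ] (λ r → (n C r) × T (suc r))
  Σ-pascal n T = begin
    Σ[0≤r≤ suc n ] (λ r → (suc n C r) × T r)
      ≈⟨ Σ-unfoldˡ n _ ⟩
    (suc n C 0) × T 0 + Σ[0≤r≤ n ] (λ r → (suc n C suc r) × T (suc r))
      ≈⟨ +-cong (×-congˡ (P.trans (nC0≡1 (suc n)) (P.sym (nC0≡1 n)))) (Σ-cong n pascal) ⟩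
    (n C 0) × T 0 + Σ[0≤r≤ n ] (λ r → (n C suc r) × T (suc r) + (n C r) × T (suc r))
      ≈⟨ +-congˡ (Σ-distrib-+ n _ _) ⟩
    (n C 0) × T 0 + (Σ[0≤r≤ n ] (λ r → (n C suc r) × T (suc r)) + Σ[0≤r≤ n ] (λ r → (n C r) × T (suc r)))
      ≈⟨ trans (sym (+-assoc _ _ _)) (+-congʳ (sym (Σ-unfoldˡ n _))) ⟩
    Σ[0≤r≤ suc n ] (λ r → (n C r) × T r) + Σ[0≤r≤ n ] (λ r → (n C r) × T (suc r))
      ≈⟨ +-congʳ (trans (+-congˡ top) (+-identityʳ _)) ⟩
    Σ[0≤r≤ n ] (λ r → (n C r) × T r) + Σ[0≤r≤ n ] (λ r → (n C r) × T (suc r)) ∎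
    where
    pascal : ∀ r → (suc n C suc r) × T (suc r) ≈ (n C suc r) × T (suc r) + (n C r) × T (suc r)
    pascal r = trans (×-congˡ (P.trans (P.sym (nCk+nC[k+1]≡[n+1]C[k+1] n r)) (NP.+-comm (n C r) _)))
                     (×-homo-+ (T (suc r)) (n C suc r) (n C r))
    top : (n C suc n) × T (suc n) ≈ 0#
    top = ×-congˡ (k>n⇒nCk≡0 (NP.n<1+n n))

  Δ[_] : ℕ → (ℕ → Carrier) → ℕ → Carrier
  Δ[ j ] f n = Σ[0≤r≤ j ] (λ r → (j C r) × ((- 1#) ^ (j ∸ r) * f (n N.+ r)))

  Δ-cong : ∀ j {f g : ℕ → Carrier} n → (∀ m → f m ≈ g m) → Δ[ j ] f n ≈ Δ[ j ] g n
  Δ-cong j n f≈g = Σ-cong j (λ r → ×-congʳ (j C r) (*-congˡ (f≈g (n N.+ r))))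

  Δ-suc : ∀ j f n → Δ[ suc j ] f n ≈ Δ[ j ] f (suc n) + - Δ[ j ] f n
  Δ-suc j f n = begin
    Δ[ suc j ] f n
      ≈⟨ Σ-pascal j (λ r → (- 1#) ^ (suc j ∸ r) * f (n N.+ r)) ⟩
    Σ[0≤r≤ j ] (λ r → (j C r) × ((- 1#) ^ (suc j ∸ r) * f (n N.+ r)))
      + Σ[0≤r≤ j ] (λ r → (j C r) × ((- 1#) ^ (j ∸ r) * f (n N.+ suc r)))
      ≈⟨ +-cong (Σ-cong≤ j flip-sign)
                (Σ-cong j (λ r → ×-congʳ (j C r) (*-congˡ (reflexive (P.cong f (NP.+-suc n r)))))) ⟩
    Σ[0≤r≤ j ] (λ r → - ((j C r) × ((- 1#) ^ (j ∸ r) * f (n N.+ r)))) + Δ[ j ] f (suc n)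
      ≈⟨ trans (+-congʳ (sym (-‿distrib-Σ j _))) (+-comm _ _) ⟩
    Δ[ j ] f (suc n) + - Δ[ j ] f n ∎
    where
    sign-suc : ∀ r → r N.≤ j → (- 1#) ^ (suc j ∸ r) ≈ - (- 1#) ^ (j ∸ r)
    sign-suc r r≤j = trans (^-congʳ (- 1#) (NP.+-∸-assoc 1 r≤j)) (-1*x≈-x _)
    flip-sign : ∀ r → r N.≤ j → (j C r) × ((- 1#) ^ (suc j ∸ r) * f (n N.+ r))
                              ≈ - ((j C r) × ((- 1#) ^ (j ∸ r) * f (n N.+ r)))
    flip-sign r r≤j = trans (×-congʳ (j C r) (trans (*-congʳ (sign-suc r r≤j)) (sym (-‿distribˡ-* _ _))))
                            (×-neg (j C r) _)

  Δ-zero : ∀ f n → Δ[ 0 ] f n ≈ f n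
  Δ-zero f n = trans (+-identityʳ _) (trans (*-identityˡ _) (reflexive (P.cong f (NP.+-identityʳ n))))

  Δ-+ : ∀ j₁ j₂ f n → Δ[ j₁ N.+ j₂ ] f n ≈ Δ[ j₁ ] (Δ[ j₂ ] f) n
  Δ-+ zero j₂ f n = sym (Δ-zero (Δ[ j₂ ] f) n)
  Δ-+ (suc j₁) j₂ f n = begin
    Δ[ suc (j₁ N.+ j₂) ] f n
      ≈⟨ Δ-suc (j₁ N.+ j₂) f n ⟩
    Δ[ j₁ N.+ j₂ ] f (suc n) + - Δ[ j₁ N.+ j₂ ] f n
      ≈⟨ +-cong (Δ-+ j₁ j₂ f (suc n)) (-‿cong (Δ-+ j₁ j₂ f n)) ⟩
    Δ[ j₁ ] (Δ[ j₂ ] f) (suc n) + - Δ[ j₁ ] (Δ[ j₂ ] f) n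
      ≈⟨ sym (Δ-suc j₁ (Δ[ j₂ ] f) n) ⟩
    Δ[ suc j₁ ] (Δ[ j₂ ] f) n ∎

  *-distribˡ-Δ : ∀ j x f n → x * Δ[ j ] f n ≈ Δ[ j ] (λ m → x * f m) n
  *-distribˡ-Δ j x f n = trans (*-distribˡ-Σ j x _)
    (Σ-cong j (λ r → trans (×-comm-* (j C r) x _) (×-congʳ (j C r) (*-Properties.x∙yz≈y∙xz x _ _))))

  Δ-Σ : ∀ i j (a : ℕ → ℕ) (h : ℕ → ℕ → Carrier) n →
    Σ[0≤r≤ i ] (λ s → a s × Δ[ j ] (h s) n) ≈ Δ[ j ] (λ m → Σ[0≤r≤ i ] (λ s → a s × h s m)) n
  Δ-Σ i j a h n = begin
    Σ[0≤r≤ i ] (λ s → a s × Δ[ j ] (h s) n)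
      ≈⟨ Σ-cong i (λ s → ×-distrib-Σ j (a s) _) ⟩
    Σ[0≤r≤ i ] (λ s → Σ[0≤r≤ j ] (λ r → a s × term s r))
      ≈⟨ Σ-comm i j _ ⟩
    Σ[0≤r≤ j ] (λ r → Σ[0≤r≤ i ] (λ s → a s × term s r))
      ≈⟨ Σ-cong j (λ r → sym (pull-out r)) ⟩
    Δ[ j ] (λ m → Σ[0≤r≤ i ] (λ s → a s × h s m)) n ∎
    where
    term : ℕ → ℕ → Carrier
    term s r = (j C r) × ((- 1#) ^ (j ∸ r) * h s (n N.+ r))
    pull-out : ∀ r → (j C r) × ((- 1#) ^ (j ∸ r) * Σ[0≤r≤ i ] (λ s → a s × h s (n N.+ r)))
                     ≈ Σ[0≤r≤ i ] (λ s → a s × term s r)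
    pull-out r = begin
      (j C r) × ((- 1#) ^ (j ∸ r) * Σ[0≤r≤ i ] (λ s → a s × h s (n N.+ r)))
        ≈⟨ trans (×-congʳ (j C r) (*-distribˡ-Σ i _ _)) (×-distrib-Σ i (j C r) _) ⟩
      Σ[0≤r≤ i ] (λ s → (j C r) × ((- 1#) ^ (j ∸ r) * (a s × h s (n N.+ r))))
        ≈⟨ Σ-cong i (λ s → trans (×-congʳ (j C r) (×-comm-* (a s) _ _)) (×-swap (j C r) (a s) _)) ⟩
      Σ[0≤r≤ i ] (λ s → a s × term s r) ∎

  Δ-Σ-weighted : ∀ i j (a : ℕ → ℕ) (w : ℕ → Carrier) (h : ℕ → ℕ → Carrier) n →
    Σ[0≤r≤ i ] (λ s → a s × (w s * Δ[ j ] (h s) n)) ≈ Δ[ j ] (λ m → Σ[0≤r≤ i ] (λ s → a s × (w s * h s m))) n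
  Δ-Σ-weighted i j a w h n =
    trans (Σ-cong i (λ s → ×-congʳ (a s) (*-distribˡ-Δ j (w s) (h s) n))) (Δ-Σ i j a (λ s m → w s * h s m) n)

  Δ-*-separable : ∀ j₁ j₂ (g h : ℕ → Carrier) →
    Δ[ j₁ ] g 0 * Δ[ j₂ ] h 0 ≈ Δ[ j₁ ] (λ r₁ → Δ[ j₂ ] (λ r₂ → g r₁ * h r₂) 0) 0
  Δ-*-separable j₁ j₂ g h = trans (*-comm _ _) (trans (*-distribˡ-Δ j₁ (Δ[ j₂ ] h 0) g 0)
    (Δ-cong j₁ 0 (λ r₁ → trans (*-comm _ _) (*-distribˡ-Δ j₂ (g r₁) h 0))))

  Δ-⟦⟧* : ∀ j (g : ℕ → Carrier) → Δ[ suc j ] (λ m → ⟦ m ⟧ * g m) 0 ≈ suc j × Δ[ j ] (λ m → g (suc m)) 0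
  Δ-⟦⟧* j g = begin
    Δ[ suc j ] (λ m → ⟦ m ⟧ * g m) 0
      ≈⟨ Σ-unfoldˡ j _ ⟩
    (suc j C 0) × ((- 1#) ^ suc j * (0# * g 0)) + Σ[0≤r≤ j ] (λ m → (suc j C suc m) × (sign m * (⟦ suc m ⟧ * g (suc m))))
      ≈⟨ +-cong first (Σ-cong j absorb) ⟩
    0# + Σ[0≤r≤ j ] (λ m → suc j × ((j C m) × (sign m * g (suc m))))
      ≈⟨ trans (+-identityˡ _) (sym (×-distrib-Σ j (suc j) _)) ⟩
    suc j × Δ[ j ] (λ m → g (suc m)) 0 ∎
    where
    sign : ℕ → Carrier
    sign m = (- 1#) ^ (j ∸ m)
    first : (suc j C 0) × ((- 1#) ^ suc j * (0# * g 0)) ≈ 0#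
    first = trans (×-congʳ (suc j C 0) (trans (*-congˡ (zeroˡ (g 0))) (zeroʳ _))) (×-zeroʳ (suc j C 0))
    absorb : ∀ m → (suc j C suc m) × (sign m * (⟦ suc m ⟧ * g (suc m))) ≈ suc j × ((j C m) × (sign m * g (suc m)))
    absorb m = begin
      (suc j C suc m) × (sign m * (⟦ suc m ⟧ * g (suc m)))
        ≈⟨ ×-congʳ (suc j C suc m) (trans (*-Properties.x∙yz≈y∙xz (sign m) ⟦ suc m ⟧ _)
             (trans (×-assoc-* (suc m) 1# _) (×-congʳ (suc m) (*-identityˡ _)))) ⟩
      (suc j C suc m) × (suc m × (sign m * g (suc m)))
        ≈⟨ ×-assocˡ _ (suc j C suc m) (suc m) ⟩
      ((suc j C suc m) N.* suc m) × (sign m * g (suc m))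
        ≈⟨ ×-congˡ (P.trans (NP.*-comm _ (suc m)) ([1+k]*[1+n]C[1+k]≡[1+n]*nCk j m)) ⟩
      (suc j N.* (j C m)) × (sign m * g (suc m))
        ≈⟨ sym (×-assocˡ _ (suc j) (j C m)) ⟩
      suc j × ((j C m) × (sign m * g (suc m))) ∎

  b-translate : ∀ i j k₁ k₂ → b i j (k₁ + k₂) ≈ Σ[0≤r≤ i ] (λ r → (i C r) × (k₁ ^ (i ∸ r) * b r j k₂))
  b-translate i j k₁ k₂ = begin
    b i j (k₁ + k₂)
      ≡⟨⟩
    Δ[ j ] (λ m → (⟦ m ⟧ + (k₁ + k₂)) ^ i) 0
      ≈⟨ Δ-cong j 0 expand ⟩
    Δ[ j ] (λ m → Σ[0≤r≤ i ] (λ r → (i C r) × (k₁ ^ (i ∸ r) * (⟦ m ⟧ + k₂) ^ r))) 0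
      ≈⟨ sym (Δ-Σ-weighted i j (i C_) (λ r → k₁ ^ (i ∸ r)) (λ r m → (⟦ m ⟧ + k₂) ^ r) 0) ⟩
    Σ[0≤r≤ i ] (λ r → (i C r) × (k₁ ^ (i ∸ r) * b r j k₂)) ∎
    where
    expand : ∀ m → (⟦ m ⟧ + (k₁ + k₂)) ^ i ≈ Σ[0≤r≤ i ] (λ r → (i C r) × (k₁ ^ (i ∸ r) * (⟦ m ⟧ + k₂) ^ r))
    expand m = trans (^-congˡ i (trans (+-congˡ (+-comm k₁ k₂)) (sym (+-assoc _ k₂ k₁))))
                 (trans (binomial i (⟦ m ⟧ + k₂) k₁) (Σ-cong i (λ r → ×-congʳ (i C r) (*-comm _ _))))

  b-via-b₀ : ∀ i j k → b i j k ≈ Σ[0≤r≤ i ] (λ r → (i C r) × (k ^ (i ∸ r) * b r j 0#))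
  b-via-b₀ i j k = trans (Δ-cong j 0 (λ m → ^-congˡ i (+-congˡ (sym (+-identityʳ k))))) (b-translate i j k 0#)

  b₀-via-b-neg : ∀ i j k → b i j 0# ≈ Σ[0≤r≤ i ] (λ r → (i C r) × (k ^ r * b (i ∸ r) j (- k)))
  b₀-via-b-neg i j k = begin
    b i j 0#
      ≡⟨⟩
    Δ[ j ] (λ m → (⟦ m ⟧ + 0#) ^ i) 0
      ≈⟨ Δ-cong j 0 expand ⟩
    Δ[ j ] (λ m → Σ[0≤r≤ i ] (λ r → (i C r) × (k ^ r * (⟦ m ⟧ + - k) ^ (i ∸ r)))) 0
      ≈⟨ sym (Δ-Σ-weighted i j (i C_) (k ^_) (λ r m → (⟦ m ⟧ + - k) ^ (i ∸ r)) 0) ⟩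
    Σ[0≤r≤ i ] (λ r → (i C r) × (k ^ r * b (i ∸ r) j (- k))) ∎
    where
    expand : ∀ m → (⟦ m ⟧ + 0#) ^ i ≈ Σ[0≤r≤ i ] (λ r → (i C r) × (k ^ r * (⟦ m ⟧ + - k) ^ (i ∸ r)))
    expand m = trans (^-congˡ i (sym (trans (+-Properties.x∙yz≈y∙xz k _ _) (+-congˡ (-‿inverseʳ k)))))
                 (binomial i k (⟦ m ⟧ + - k))

  b₀-convolution : ∀ i j₁ j₂ k →
    b i (j₁ N.+ j₂) 0# ≈ Σ[0≤r≤ i ] (λ r → (i C r) × (b r j₁ k * b (i ∸ r) j₂ (- k)))
  b₀-convolution i j₁ j₂ k = begin
    b i (j₁ N.+ j₂) 0#
      ≈⟨ Δ-+ j₁ j₂ F 0 ⟩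
    Δ[ j₁ ] (λ r₁ → Δ[ j₂ ] (λ r₂ → F (r₁ N.+ r₂)) 0) 0
      ≈⟨ Δ-cong j₁ 0 (λ r₁ → Δ-cong j₂ 0 (expand r₁)) ⟩
    Δ[ j₁ ] (λ r₁ → Δ[ j₂ ] (λ r₂ → Σ[0≤r≤ i ] (λ s → (i C s) × (G s r₁ * H s r₂))) 0) 0
      ≈⟨ Δ-cong j₁ 0 (λ r₁ → sym (Δ-Σ i j₂ (i C_) (λ s r₂ → G s r₁ * H s r₂) 0)) ⟩
    Δ[ j₁ ] (λ r₁ → Σ[0≤r≤ i ] (λ s → (i C s) × Δ[ j₂ ] (λ r₂ → G s r₁ * H s r₂) 0)) 0
      ≈⟨ sym (Δ-Σ i j₁ (i C_) (λ s r₁ → Δ[ j₂ ] (λ r₂ → G s r₁ * H s r₂) 0) 0) ⟩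
    Σ[0≤r≤ i ] (λ s → (i C s) × Δ[ j₁ ] (λ r₁ → Δ[ j₂ ] (λ r₂ → G s r₁ * H s r₂) 0) 0)
      ≈⟨ Σ-cong i (λ s → ×-congʳ (i C s) (sym (Δ-*-separable j₁ j₂ (G s) (H s)))) ⟩
    Σ[0≤r≤ i ] (λ s → (i C s) × (b s j₁ k * b (i ∸ s) j₂ (- k))) ∎
    where
    F : ℕ → Carrier
    F m = (⟦ m ⟧ + 0#) ^ i
    G : ℕ → ℕ → Carrier
    G s r₁ = (⟦ r₁ ⟧ + k) ^ s
    H : ℕ → ℕ → Carrier
    H s r₂ = (⟦ r₂ ⟧ + - k) ^ (i ∸ s)
    expand : ∀ r₁ r₂ → F (r₁ N.+ r₂) ≈ Σ[0≤r≤ i ] (λ s → (i C s) × (G s r₁ * H s r₂))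
    expand r₁ r₂ = trans (^-congˡ i (trans (+-cong (×-homo-+ 1# r₁ r₂) (sym (-‿inverseʳ k)))
                                           (+-Properties.interchange _ _ _ _)))
                         (binomial i (⟦ r₁ ⟧ + k) (⟦ r₂ ⟧ + - k))

  b-raise : ∀ i j k → suc j × b i j (k + 1#) ≈ Σ[0≤r≤ i ] (λ r → (i C r) × (k ^ (i ∸ r) * b (suc r) (suc j) 0#))
  b-raise i j k = sym (begin
    Σ[0≤r≤ i ] (λ r → (i C r) × (k ^ (i ∸ r) * b (suc r) (suc j) 0#))
      ≈⟨ Δ-Σ-weighted i (suc j) (i C_) (λ r → k ^ (i ∸ r)) (λ r m → (⟦ m ⟧ + 0#) ^ suc r) 0 ⟩
    Δ[ suc j ] (λ m → Σ[0≤r≤ i ] (λ r → (i C r) × (k ^ (i ∸ r) * (⟦ m ⟧ + 0#) ^ suc r))) 0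
      ≈⟨ Δ-cong (suc j) 0 collapse ⟩
    Δ[ suc j ] (λ m → ⟦ m ⟧ * (⟦ m ⟧ + k) ^ i) 0
      ≈⟨ Δ-⟦⟧* j (λ m → (⟦ m ⟧ + k) ^ i) ⟩
    suc j × Δ[ j ] (λ m → (⟦ suc m ⟧ + k) ^ i) 0
      ≈⟨ ×-congʳ (suc j) (Δ-cong j 0 (λ m → ^-congˡ i (shift m))) ⟩
    suc j × b i j (k + 1#) ∎)
    where
    shift : ∀ m → ⟦ suc m ⟧ + k ≈ ⟦ m ⟧ + (k + 1#)
    shift m = trans (+-congʳ (+-comm 1# _)) (trans (+-assoc _ 1# k) (+-congˡ (+-comm 1# k)))
    collapse : ∀ m → Σ[0≤r≤ i ] (λ r → (i C r) × (k ^ (i ∸ r) * (⟦ m ⟧ + 0#) ^ suc r)) ≈ ⟦ m ⟧ * (⟦ m ⟧ + k) ^ i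
    collapse m = begin
      Σ[0≤r≤ i ] (λ r → (i C r) × (k ^ (i ∸ r) * (z * z ^ r)))
        ≈⟨ Σ-cong i (λ r → trans (×-congʳ (i C r) (*-Properties.x∙yz≈y∙zx _ _ _)) (sym (×-comm-* (i C r) z _))) ⟩
      Σ[0≤r≤ i ] (λ r → z * ((i C r) × (z ^ r * k ^ (i ∸ r))))
        ≈⟨ sym (*-distribˡ-Σ i z _) ⟩
      z * Σ[0≤r≤ i ] (λ r → (i C r) × (z ^ r * k ^ (i ∸ r)))
        ≈⟨ *-congˡ (sym (binomial i z k)) ⟩
      z * (z + k) ^ i
        ≈⟨ *-cong (+-identityʳ _) (^-congˡ i (+-congʳ (+-identityʳ _))) ⟩
      ⟦ m ⟧ * (⟦ m ⟧ + k) ^ i ∎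
      where
      z = ⟦ m ⟧ + 0#

mainTheorem9 : ∀ {c ℓ : Level} (R : CommutativeRing c ℓ) →
  let open CommutativeRing R
      open Ops R
  in
  -- (a)
  (∀ (i j₁ j₂ : ℕ) (k : Carrier) →
    b i (j₁ N.+ j₂) 0# ≈ Σ[0≤r≤ i ] (λ r → (i C r) × (b r j₁ k * b (i ∸ r) j₂ (- k))))
  ∧
  -- (b)
  (∀ (i j : ℕ) (k : Carrier) →
    b i j 0# ≈ Σ[0≤r≤ i ] (λ r → (i C r) × (k ^ r * b (i ∸ r) j (- k))))
  ∧
  -- (c)
  (∀ (i j : ℕ) (k : Carrier) →
    b i j k ≈ Σ[0≤r≤ i ] (λ r → (i C r) × (k ^ (i ∸ r) * b r j 0#)))
  ∧
  -- (d)
  (∀ (i j : ℕ) (k₁ k₂ : Carrier) →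
    b i j (k₁ + k₂) ≈ Σ[0≤r≤ i ] (λ r → (i C r) × (k₁ ^ (i ∸ r) * b r j k₂)))
  ∧
  -- (e)
  (∀ (i j : ℕ) (k : Carrier) → 1 N.≤ j →
    j × b i (j ∸ 1) (k + 1#) ≈ Σ[0≤r≤ i ] (λ r → (i C r) × (k ^ (i ∸ r) * b (suc r) j 0#)))
mainTheorem9 R =
  b₀-convolution R , b₀-via-b-neg R , b-via-b₀ R , b-translate R , λ { i (suc j) k _ → b-raise R i j k }
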